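{- Let $G$ be a graph and $T\subseteq V(G)$. Color the vertices of $T$ black and the others white. Consider the one-player game in which, at each turn, the player removes a white vertex and flips the color (black to white, white to black) of each of its remaining neighbors. Then $G$ admits an acyclic $T$-odd orientation if and only if it is possible to remove all vertices of $G$ following these rules.
   Context: Graphs are finite and simple. An orientation of $G$ is $T$-odd if every vertex $v$ has odd in-degree iff $v\in T$; it is acyclic if it contains no directed cycle. -}

module Defs where

open import Data.Nat using (ℕ; zero; suc; _+_; _%_)
open import Data.Bool using (Bool; true; false; not; if_then_else_; _∧_)
open import Data.Fin using (Fin; zero; suc; inject₁; fromℕ; _≟_)
open import Data.List using (List; map; allFin)
open import Data.Nat.ListAction using (sum)
open import Data.Product using (Σ; ∃; _×_; _,_)
open import Data.Sum using (_⊎_)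
open import Relation.Nullary using (¬_; yes; no)
open import Relation.Binary.PropositionalEquality using (_≡_)
open import Relation.Binary.Construct.Closure.ReflexiveTransitive using (Star)
open import Function.Definitions using (Injective)
open import Function.Bundles using (_⇔_)

record Graph (n : ℕ) : Set where
  field
    Adj    : Fin n → Fin n → Bool
    sym    : ∀ u v → Adj u v ≡ Adj v u
    irrefl : ∀ v → Adj v v ≡ false
open Graph public

record Orientation {n : ℕ} (G : Graph n) : Set where
  field
    arc     : Fin n → Fin n → Bool
    arc-adj : ∀ u v → arc u v ≡ true → Adj G u v ≡ true
    arc-tot : ∀ u v → Adj G u v ≡ true → arc u v ≡ true ⊎ arc v u ≡ true
    arc-asy : ∀ u v → arc u v ≡ true → arc v u ≡ false
open Orientation public

boolToℕ : Bool → ℕ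
boolToℕ true  = 1
boolToℕ false = 0

indeg : ∀ {n} {G : Graph n} → Orientation G → Fin n → ℕ
indeg {n} D v = sum (map (λ u → boolToℕ (arc D u v)) (allFin n))

IsTOdd : ∀ {n} {G : Graph n} → (Fin n → Bool) → Orientation G → Set
IsTOdd T D = ∀ v → (indeg D v % 2 ≡ 1) ⇔ (T v ≡ true)

record DirectedCycle {n : ℕ} {G : Graph n} (D : Orientation G) : Set where
  field
    k     : ℕ
    c     : Fin (suc k) → Fin n
    inj   : Injective _≡_ _≡_ c
    step  : ∀ (i : Fin k) → arc D (c (inject₁ i)) (c (suc i)) ≡ true
    close : arc D (c (fromℕ k)) (c zero) ≡ true

Acyclic : ∀ {n} {G : Graph n} → Orientation G → Set
Acyclic D = ¬ DirectedCycle D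

-- The game. A state records which vertices have been removed and the
-- current colour of each vertex (true = black, false = white).
record GameState (n : ℕ) : Set where
  constructor state
  field
    removed : Fin n → Bool
    colour  : Fin n → Bool
open GameState public

initial : ∀ {n} → (Fin n → Bool) → GameState n
initial T = state (λ _ → false) T

remove : ∀ {n} → Graph n → Fin n → GameState n → GameState n
remove G v s = state
  (λ w → if does (w ≟ v) then true else removed s w)
  (λ w → if Adj G v w ∧ not (removed s w) then not (colour s w) else colour s w)
  where open import Relation.Nullary using (does)

data Move {n : ℕ} (G : Graph n) : GameState n → GameState n → Set where
  move : ∀ s v → removed s v ≡ false → colour s v ≡ false →
         Move G s (remove G v s)

AllRemoved : ∀ {n} → GameState n → Set
AllRemoved {n} s = ∀ (v : Fin n) → removed s v ≡ true

Winnable : ∀ {n} → Graph n → (Fin n → Bool) → Set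
Winnable G T = ∃ λ s → Star (Move G) (initial T) s × AllRemoved s

{-# OPTIONS --safe #-}
-- Fix an orientation D and call a position parity-coloured if every remaining
-- vertex is black exactly when it has an odd number of remaining in-neighbours;
-- the initial position is parity-coloured iff D is T-odd. Let v be a remaining
-- vertex without remaining in-neighbours, so that its remaining neighbours are
-- exactly the remaining vertices having v as an in-neighbour. Removing v flips
-- the colours of precisely these vertices while lowering their count by one, so
-- the position is parity-coloured iff v is white and the position after removing
-- v is parity-coloured. If D is acyclic such a v always exists, and the game is
-- won greedily. Conversely, orient every edge away from the endpoint removed
-- first in a winning play: this orientation is acyclic, each removed vertex has
-- no remaining in-neighbour, and reading the play backwards shows that every
-- position, the initial one included, is parity-coloured.
module Submission where

open import Defs hiding (sym; irrefl)
open import Data.Bool using (Bool; true; false; not; _∧_; _xor_; if_then_else_)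
import Data.Bool.Properties as Bool
open import Data.Bool.Properties
  using (not-involutive; not-injective; ¬-not; ∧-conicalˡ; ∧-conicalʳ; ∧-zeroʳ; ∧-identityʳ;
         ⇔→≡; T-≡)
open import Data.Empty using (⊥-elim)
open import Data.Fin using (Fin; zero; suc; inject₁; inject≤; fromℕ; toℕ; _≟_)
open import Data.Fin.Properties
  using (toℕ-injective; toℕ-inject₁; toℕ-inject≤; toℕ-fromℕ; toℕ<n; inject≤-injective;
         any?; all?; ¬∀⟶∃¬; <⇒notInjective)
import Data.Fin.Properties as Fin
open import Data.List using (map; allFin; tabulate)
open import Data.List.Properties using (map-tabulate)
open import Data.Nat using (ℕ; zero; suc; _+_; _<_; _≤_; _<?_; _%_)
open import Data.Nat.Properties
  using (≤-refl; ≤-trans; ≤-pred; <⇒≤; <-irrefl; <-asym; <-≤-trans; <-cmp; n<1+n; 0≢1+n;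
         suc-injective; <ᵇ⇒<; m+n≡0⇒m≡0; m+n≡0⇒n≡0; +-commutativeSemigroup)
open import Algebra.Properties.CommutativeSemigroup +-commutativeSemigroup using (x∙yz≈y∙xz)
open import Data.Nat.ListAction using (sum)
open import Data.Product using (∃; _×_; _,_)
open import Data.Sum using (_⊎_; inj₁; inj₂)
open import Data.Vec.Functional using (_∷_)
open import Function using (_∘_; id)
open import Function.Bundles using (_⇔_; mk⇔; Equivalence)
import Function.Properties.Equivalence as ⇔
open import Function.Definitions using (Injective)
open import Relation.Binary.Definitions using (tri<; tri≈; tri>)
open import Relation.Binary.PropositionalEquality
open import Relation.Binary.Construct.Closure.ReflexiveTransitive using (Star; ε; _◅_)
open import Relation.Nullary using (yes; no; does; contradiction)
open import Relation.Nullary.Decidable using (_×-dec_; dec-true; dec-false)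

count : ∀ {n} → (Fin n → Bool) → ℕ
count {zero}  f = 0
count {suc n} f = boolToℕ (f zero) + count (f ∘ suc)

sum-map-allFin : ∀ n (f : Fin n → Bool) → sum (map (λ u → boolToℕ (f u)) (allFin n)) ≡ count f
sum-map-allFin n f = trans (cong sum (map-tabulate id (boolToℕ ∘ f))) (sum-tabulate n f)
  where
  sum-tabulate : ∀ m (g : Fin m → Bool) → sum (tabulate (boolToℕ ∘ g)) ≡ count g
  sum-tabulate zero    g = refl
  sum-tabulate (suc m) g = cong (boolToℕ (g zero) +_) (sum-tabulate m (g ∘ suc))

count-cong : ∀ {n} {f g : Fin n → Bool} → (∀ u → f u ≡ g u) → count f ≡ count g
count-cong {zero}  f≗g = refl
count-cong {suc n} f≗g = cong₂ _+_ (cong boolToℕ (f≗g zero)) (count-cong (f≗g ∘ suc))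

count-split : ∀ {n} {f g : Fin n → Bool} v → (∀ u → u ≢ v → f u ≡ g u) → g v ≡ false →
              count f ≡ boolToℕ (f v) + count g
count-split {suc n} {f} zero f≗g gv rewrite gv =
  cong (boolToℕ (f zero) +_) (count-cong (λ u → f≗g (suc u) λ ()))
count-split {suc n} {f} {g} (suc v) f≗g gv
  rewrite f≗g zero (λ ())
        | count-split v (λ u u≢v → f≗g (suc u) (u≢v ∘ Fin.suc-injective)) gv
  = x∙yz≈y∙xz (boolToℕ (g zero)) (boolToℕ (f (suc v))) (count (g ∘ suc))

all-false⇒count≡0 : ∀ {n} {f : Fin n → Bool} → (∀ u → f u ≡ false) → count f ≡ 0
all-false⇒count≡0 {zero}      f≡false = refl
all-false⇒count≡0 {suc n} {f} f≡false rewrite f≡false zero = all-false⇒count≡0 (f≡false ∘ suc)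

count≡0⇒all-false : ∀ {n} {f : Fin n → Bool} → count f ≡ 0 → ∀ u → f u ≡ false
count≡0⇒all-false {suc n} {f} none zero    = boolToℕ≡0 (m+n≡0⇒m≡0 _ none)
  where
  boolToℕ≡0 : ∀ {b} → boolToℕ b ≡ 0 → b ≡ false
  boolToℕ≡0 {false} _ = refl
count≡0⇒all-false {suc n} {f} none (suc u) = count≡0⇒all-false (m+n≡0⇒n≡0 (boolToℕ (f zero)) none) u

count≡suc⇒witness : ∀ {n m} {f : Fin n → Bool} → count f ≡ suc m → ∃ λ u → f u ≡ true
count≡suc⇒witness {suc n} {f = f} some with f zero in f0
... | true  = zero , f0
... | false with count≡suc⇒witness some
...   | u , fu = suc u , fu

odd : ℕ → Bool
odd zero    = false
odd (suc n) = not (odd n)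

odd-boolToℕ-+ : ∀ b m → odd (boolToℕ b + m) ≡ b xor odd m
odd-boolToℕ-+ true  m = refl
odd-boolToℕ-+ false m = refl

odd⇔%2≡1 : ∀ m → odd m ≡ true ⇔ m % 2 ≡ 1
odd⇔%2≡1 zero          = mk⇔ (λ ()) (λ ())
odd⇔%2≡1 (suc zero)    = mk⇔ (λ _ → refl) (λ _ → refl)
odd⇔%2≡1 (suc (suc m)) rewrite not-involutive (odd m) = odd⇔%2≡1 m

≡odd⇔ : ∀ b m → (b ≡ odd m) ⇔ (m % 2 ≡ 1 ⇔ b ≡ true)
≡odd⇔ b m = mk⇔
  (λ { refl → ⇔.sym (odd⇔%2≡1 m) })
  (λ odd⇔b → ⇔→≡ (⇔.trans (⇔.sym odd⇔b) (⇔.sym (odd⇔%2≡1 m))))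

≡xor⇔xor≡ : ∀ b c p → (c ≡ b xor p) ⇔ (b xor c ≡ p)
≡xor⇔xor≡ false c p = mk⇔ id id
≡xor⇔xor≡ true  c p = mk⇔ (λ e → trans (cong not e) (not-involutive p))
                          (λ e → trans (sym (not-involutive c)) (cong not e))

countLive : ∀ {n} → GameState n → (Fin n → Bool) → ℕ
countLive s h = count (λ u → not (removed s u) ∧ h u)

countLive-cong : ∀ {n} {s : GameState n} {h h′ : Fin n → Bool} →
                 (∀ u → removed s u ≡ false → h u ≡ h′ u) → countLive s h ≡ countLive s h′
countLive-cong {s = s} {h} {h′} h≗h′ = count-cong pointwise
  where
  pointwise : ∀ u → (not (removed s u) ∧ h u) ≡ (not (removed s u) ∧ h′ u)
  pointwise u with removed s u in ru
  ... | true  = refl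
  ... | false = h≗h′ u ru

countLive≡0⇒allRemoved : ∀ {n} {s : GameState n} → countLive s (λ _ → true) ≡ 0 → AllRemoved s
countLive≡0⇒allRemoved none u =
  not-injective (trans (sym (∧-identityʳ _)) (count≡0⇒all-false none u))

countLive≡suc⇒live : ∀ {n m} {s : GameState n} → countLive s (λ _ → true) ≡ suc m →
                     ∃ λ u → removed s u ≡ false
countLive≡suc⇒live some with count≡suc⇒witness some
... | u , live = u , not-injective {y = false} (∧-conicalˡ _ _ live)

-- a u w ≡ true is read as an arc u → w.
liveIndegree : ∀ {n} → (Fin n → Fin n → Bool) → GameState n → Fin n → ℕ
liveIndegree a s w = countLive s (λ u → a u w)

IsLiveSource : ∀ {n} → (Fin n → Fin n → Bool) → GameState n → Fin n → Set
IsLiveSource a s v = ∀ u → removed s u ≡ false → a u v ≡ false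

liveSource⇒liveIndegree≡0 : ∀ {n} {a : Fin n → Fin n → Bool} {s v} →
                            IsLiveSource a s v → liveIndegree a s v ≡ 0
liveSource⇒liveIndegree≡0 {a = a} {s} {v} source = all-false⇒count≡0 noLiveIn
  where
  noLiveIn : ∀ u → (not (removed s u) ∧ a u v) ≡ false
  noLiveIn u with removed s u in ru
  ... | true  = refl
  ... | false = source u ru

ParityColoured : ∀ {n} → (Fin n → Fin n → Bool) → GameState n → Set
ParityColoured a s = ∀ w → removed s w ≡ false → colour s w ≡ odd (liveIndegree a s w)

parityColoured-cong : ∀ {n} {a b : Fin n → Fin n → Bool} {s} →
                      (∀ u w → removed s u ≡ false → removed s w ≡ false → a u w ≡ b u w) →
                      ParityColoured a s → ParityColoured b s
parityColoured-cong {s = s} a≗b coloured w rw =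
  trans (coloured w rw) (cong odd (countLive-cong {s = s} (λ u ru → a≗b u w ru rw)))

parityColoured-initial : ∀ {n} {G : Graph n} (D : Orientation G) {T} →
                         ParityColoured (arc D) (initial T) ⇔ IsTOdd T D
parityColoured-initial {n} D {T} = mk⇔
  (λ coloured w → Equivalence.to (≡odd⇔ (T w) (indeg D w))
                    (trans (coloured w refl) (cong odd (sym (indeg≡count w)))))
  (λ tOdd w _ → trans (Equivalence.from (≡odd⇔ (T w) (indeg D w)) (tOdd w))
                      (cong odd (indeg≡count w)))
  where
  indeg≡count : ∀ w → indeg D w ≡ count (λ u → arc D u w)
  indeg≡count w = sum-map-allFin n (λ u → arc D u w)

module _ {n : ℕ} (G : Graph n) where

  removed-remove-self : ∀ s v → removed (remove G v s) v ≡ true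
  removed-remove-self s v rewrite dec-true (v ≟ v) refl = refl

  removed-remove-other : ∀ {s v u} → u ≢ v → removed (remove G v s) u ≡ removed s u
  removed-remove-other {v = v} {u} u≢v rewrite dec-false (u ≟ v) u≢v = refl

  removed-remove⇒≢ : ∀ {s v u} → removed (remove G v s) u ≡ false → u ≢ v
  removed-remove⇒≢ {s} {v} ru refl = contradiction (trans (sym (removed-remove-self s v)) ru) λ ()

  removed-remove⇒removed : ∀ {s v u} → removed (remove G v s) u ≡ false → removed s u ≡ false
  removed-remove⇒removed {s} {v} {u} ru =
    trans (sym (removed-remove-other {s} {v} (removed-remove⇒≢ {s} {v} ru))) ru

  colour-remove : ∀ {s v w} → removed s w ≡ false →
                  colour (remove G v s) w ≡ Adj G v w xor colour s w
  colour-remove {s} {v} {w} rw rewrite rw with Adj G v w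
  ... | true  = refl
  ... | false = refl

  countLive-remove : ∀ {s v} (h : Fin n → Bool) → removed s v ≡ false →
                     countLive s h ≡ boolToℕ (h v) + countLive (remove G v s) h
  countLive-remove {s} {v} h rv =
    trans (count-split v agree (cong (λ r → not r ∧ h v) (removed-remove-self s v)))
          (cong (λ r → boolToℕ (not r ∧ h v) + countLive (remove G v s) h) rv)
    where
    agree : ∀ u → u ≢ v → (not (removed s u) ∧ h u) ≡ (not (removed (remove G v s) u) ∧ h u)
    agree u u≢v = cong (λ r → not r ∧ h u) (sym (removed-remove-other {s} {v} u≢v))

  parityColoured-remove : ∀ {a s v} → removed s v ≡ false → IsLiveSource a s v →
                          (∀ w → removed s w ≡ false → Adj G v w ≡ a v w) →
                          ParityColoured a s ⇔
                          (colour s v ≡ false × ParityColoured a (remove G v s))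
  parityColoured-remove {a} {s} {v} rv source out = mk⇔
    (λ coloured → trans (coloured v rv) v-even ,
                  λ w rw′ → let rw = removed-remove⇒removed {s} {v} rw′ in
                            Equivalence.to (at w rw) (coloured w rw))
    restore
    where
    s′ = remove G v s

    v-even : odd (liveIndegree a s v) ≡ false
    v-even = cong odd (liveSource⇒liveIndegree≡0 {a = a} {s} source)

    at : ∀ w → removed s w ≡ false →
         (colour s w ≡ odd (liveIndegree a s w)) ⇔ (colour s′ w ≡ odd (liveIndegree a s′ w))
    at w rw = subst₂ (λ x y → (colour s w ≡ x) ⇔ (y ≡ odd (liveIndegree a s′ w)))
                     (sym parity-s) (sym colour-s′) (≡xor⇔xor≡ (a v w) (colour s w) _)
      where
      parity-s : odd (liveIndegree a s w) ≡ a v w xor odd (liveIndegree a s′ w)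
      parity-s = trans (cong odd (countLive-remove {s} {v} (λ u → a u w) rv))
                       (odd-boolToℕ-+ (a v w) _)
      colour-s′ : colour s′ w ≡ a v w xor colour s w
      colour-s′ = trans (colour-remove {s} {v} rw) (cong (_xor colour s w) (out w rw))

    restore : colour s v ≡ false × ParityColoured a s′ → ParityColoured a s
    restore (white , coloured′) w rw with w ≟ v
    ... | yes refl = trans white (sym v-even)
    ... | no w≢v   =
      Equivalence.from (at w rw) (coloured′ w (trans (removed-remove-other {s} {v} w≢v) rw))

record Path {n} {G : Graph n} (D : Orientation G) (S : Fin n → Bool) (k : ℕ) : Set where
  field
    vertex    : Fin (suc k) → Fin n
    injective : Injective _≡_ _≡_ vertex
    step      : ∀ (i : Fin k) → arc D (vertex (inject₁ i)) (vertex (suc i)) ≡ true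
    inside    : ∀ i → S (vertex i) ≡ true

module _ {n} {G : Graph n} {D : Orientation G} {S : Fin n → Bool} where

  path-cycleAt : ∀ {k} (P : Path D S k) (a : Fin (suc k)) →
                 arc D (Path.vertex P a) (Path.vertex P zero) ≡ true → DirectedCycle D
  path-cycleAt {k} P a a→0 = record
    { k = toℕ a ; c = c ; inj = c-injective ; step = c-step ; close = c-close }
    where
    open Path P
    c : Fin (suc (toℕ a)) → Fin n
    c i = vertex (inject≤ i (toℕ<n a))

    vertex-cong : ∀ {i j} → toℕ i ≡ toℕ j → vertex i ≡ vertex j
    vertex-cong = cong vertex ∘ toℕ-injective

    c-injective : Injective _≡_ _≡_ c
    c-injective {i} {j} = inject≤-injective _ _ i j ∘ injective

    c-step : ∀ (i : Fin (toℕ a)) → arc D (c (inject₁ i)) (c (suc i)) ≡ true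
    c-step i = subst (λ x → arc D x (c (suc i)) ≡ true) (vertex-cong same-index)
                     (step (inject≤ i (≤-pred (toℕ<n a))))
      where
      same-index : toℕ (inject₁ (inject≤ i _)) ≡ toℕ (inject≤ (inject₁ i) (toℕ<n a))
      same-index = trans (toℕ-inject₁ _) (trans (toℕ-inject≤ i _)
                     (sym (trans (toℕ-inject≤ (inject₁ i) _) (toℕ-inject₁ i))))

    c-close : arc D (c (fromℕ (toℕ a))) (c zero) ≡ true
    c-close = subst (λ x → arc D x (vertex zero) ≡ true)
                    (vertex-cong (sym (trans (toℕ-inject≤ (fromℕ (toℕ a)) _) (toℕ-fromℕ (toℕ a)))))
                    a→0

  path-extend : ∀ {k} → Acyclic D → (∀ v → S v ≡ true → ∃ λ u → S u ≡ true × arc D u v ≡ true) →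
                Path D S k → Path D S (suc k)
  path-extend {k} acyclic predecessor P with predecessor (Path.vertex P zero) (Path.inside P zero)
  ... | u , Su , u→0 with any? (λ i → Path.vertex P i ≟ u)
  ... | yes (a , refl) = ⊥-elim (acyclic (path-cycleAt P a u→0))
  ... | no fresh = record
    { vertex = u ∷ vertex ; injective = ∷-injective ; step = ∷-step ; inside = ∷-inside }
    where
    open Path P
    ∷-injective : Injective _≡_ _≡_ (u ∷ vertex)
    ∷-injective {zero}  {zero}  _ = refl
    ∷-injective {zero}  {suc j} e = ⊥-elim (fresh (j , sym e))
    ∷-injective {suc i} {zero}  e = ⊥-elim (fresh (i , e))
    ∷-injective {suc i} {suc j} e = cong suc (injective e)
    ∷-step : ∀ (i : Fin (suc k)) → arc D ((u ∷ vertex) (inject₁ i)) ((u ∷ vertex) (suc i)) ≡ true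
    ∷-step zero    = u→0
    ∷-step (suc i) = step i
    ∷-inside : ∀ i → S ((u ∷ vertex) i) ≡ true
    ∷-inside zero    = Su
    ∷-inside (suc i) = inside i

  -- Without a source every vertex of S has a predecessor in S, so paths in S of
  -- every length exist; but a path of length n repeats a vertex.
  acyclic⇒source : Acyclic D → ∃ (λ x → S x ≡ true) →
                   ∃ λ v → S v ≡ true × (∀ u → S u ≡ true → arc D u v ≡ false)
  acyclic⇒source acyclic (x , Sx)
    with any? (λ v → (S v Bool.≟ true) ×-dec all? (λ u → (S u ∧ arc D u v) Bool.≟ false))
  ... | yes (v , Sv , noIn) = v , Sv , λ u Su → subst (λ b → (b ∧ arc D u v) ≡ false) Su (noIn u)
  ... | no noSource = ⊥-elim (<⇒notInjective (n<1+n n) (Path.injective (path n)))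
    where
    predecessor : ∀ v → S v ≡ true → ∃ λ u → S u ≡ true × arc D u v ≡ true
    predecessor v Sv with ¬∀⟶∃¬ n _ (λ u → (S u ∧ arc D u v) Bool.≟ false)
                                    (λ noIn → noSource (v , Sv , noIn))
    ... | u , in-arc = u , ∧-conicalˡ _ _ (¬-not in-arc) , ∧-conicalʳ _ _ (¬-not in-arc)
    path : ∀ k → Path D S k
    path zero    = record { vertex = λ _ → x ; injective = λ { {zero} {zero} _ → refl }
                          ; step = λ () ; inside = λ _ → Sx }
    path (suc k) = path-extend acyclic predecessor (path k)

ascending⇒head≤ : ∀ k (f : Fin (suc k) → ℕ) → (∀ (i : Fin k) → f (inject₁ i) < f (suc i)) →
                  ∀ j → f zero ≤ f j
ascending⇒head≤ k       f ascending zero    = ≤-refl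
ascending⇒head≤ (suc k) f ascending (suc j) =
  ≤-trans (<⇒≤ (ascending zero)) (ascending⇒head≤ k (f ∘ suc) (ascending ∘ suc) j)

ranked⇒acyclic : ∀ {n} {G : Graph n} {D : Orientation G} (rank : Fin n → ℕ) →
                 (∀ {u w} → arc D u w ≡ true → rank u < rank w) → Acyclic D
ranked⇒acyclic rank ascends cycle =
  <-irrefl refl (<-≤-trans (ascends close)
                           (ascending⇒head≤ k (rank ∘ c) (ascends ∘ step) (fromℕ k)))
  where open DirectedCycle cycle

rankArc : ∀ {n} → Graph n → (Fin n → ℕ) → Fin n → Fin n → Bool
rankArc G rank u w = Adj G u w ∧ does (rank u <? rank w)

rankArc⇒< : ∀ {n} {G : Graph n} {rank u w} → rankArc G rank u w ≡ true → rank u < rank w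
rankArc⇒< {G = G} {rank} {u} {w} u→w =
  <ᵇ⇒< (rank u) (rank w) (Equivalence.from T-≡ (∧-conicalʳ (Adj G u w) _ u→w))

rankOrientation : ∀ {n} (G : Graph n) (rank : Fin n → ℕ) → Injective _≡_ _≡_ rank → Orientation G
rankOrientation G rank injective = record
  { arc     = rankArc G rank
  ; arc-adj = λ u w u→w → ∧-conicalˡ _ _ u→w
  ; arc-tot = total
  ; arc-asy = λ u w u→w →
      trans (cong (Adj G w u ∧_) (dec-false (rank w <? rank u) (<-asym (rankArc⇒< {G = G} u→w))))
            (∧-zeroʳ _)
  }
  where
  total : ∀ u w → Adj G u w ≡ true → rankArc G rank u w ≡ true ⊎ rankArc G rank w u ≡ true
  total u w uw with <-cmp (rank u) (rank w)
  ... | tri< u<w _ _ = inj₁ (cong₂ _∧_ uw (dec-true (rank u <? rank w) u<w))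
  ... | tri> _ _ w<u =
    inj₂ (cong₂ _∧_ (trans (Graph.sym G w u) uw) (dec-true (rank w <? rank u) w<u))
  ... | tri≈ _ u≡w _ with injective u≡w
  ...   | refl = contradiction (trans (sym uw) (Graph.irrefl G u)) λ ()

liveSource⇒adj≡arc : ∀ {n} {G : Graph n} (D : Orientation G) {s v} → IsLiveSource (arc D) s v →
                     ∀ w → removed s w ≡ false → Adj G v w ≡ arc D v w
liveSource⇒adj≡arc {G = G} D {s} {v} source w rw = ⇔→≡ (mk⇔ outgoing (arc-adj D v w))
  where
  outgoing : Adj G v w ≡ true → arc D v w ≡ true
  outgoing vw with arc-tot D v w vw
  ... | inj₁ v→w = v→w
  ... | inj₂ w→v = contradiction (trans (sym w→v) (source w rw)) λ ()

module _ {n} {G : Graph n} (D : Orientation G) (acyclic : Acyclic D) where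

  parityColoured⇒move : ∀ {s} → ParityColoured (arc D) s → ∃ (λ x → removed s x ≡ false) →
                        ∃ λ v → removed s v ≡ false × Move G s (remove G v s)
                                × ParityColoured (arc D) (remove G v s)
  parityColoured⇒move {s} coloured (x , rx)
    with acyclic⇒source {S = λ u → not (removed s u)} acyclic (x , cong not rx)
  ... | v , live-v , noLiveIn =
    let rv = not-injective {y = false} live-v
        source : IsLiveSource (arc D) s v
        source u ru = noLiveIn u (cong not ru)
        out = liveSource⇒adj≡arc D {s} source
        (white , coloured′) = Equivalence.to (parityColoured-remove G rv source out) coloured
    in v , rv , move s v rv white , coloured′

  parityColoured⇒clearable : ∀ m {s} → countLive s (λ _ → true) ≡ m →
                             ParityColoured (arc D) s → ∃ λ s′ → Star (Move G) s s′ × AllRemoved s′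
  parityColoured⇒clearable zero    {s} none _ = s , ε , countLive≡0⇒allRemoved {s = s} none
  parityColoured⇒clearable (suc m) {s} some coloured
    with parityColoured⇒move coloured (countLive≡suc⇒live {s = s} some)
  ... | v , rv , v-move , coloured′
    with parityColoured⇒clearable m
           (suc-injective (trans (sym (countLive-remove G {s} {v} _ rv)) some)) coloured′
  ... | s′ , moves , done = s′ , v-move ◅ moves , done

module _ {n} (G : Graph n) where

  -- The rank of a vertex is the number of moves before it is removed.
  winningPlay⇒ranking :
    ∀ {s s′} → Star (Move G) s s′ → AllRemoved s′ →
    ∃ λ rank → (∀ {u w} → removed s u ≡ false → removed s w ≡ false → rank u ≡ rank w → u ≡ w)
             × ParityColoured (rankArc G rank) s
  winningPlay⇒ranking {s} ε done =
    (λ _ → 0) , (λ {u} ru _ _ → dead ru) , (λ w rw → dead rw)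
    where
    dead : ∀ {u} {A : Set} → removed s u ≡ false → A
    dead {u} ru = contradiction (trans (sym (done u)) ru) λ ()
  winningPlay⇒ranking (move s v rv white ◅ moves) done with winningPlay⇒ranking moves done
  ... | rank′ , injective′ , coloured′ =
    rank , injective , Equivalence.from (parityColoured-remove G rv source out) (white , coloured)
    where
    s′ = remove G v s

    rank : Fin n → ℕ
    rank u = if does (u ≟ v) then 0 else suc (rank′ u)

    rank-self : rank v ≡ 0
    rank-self rewrite dec-true (v ≟ v) refl = refl

    rank-other : ∀ {u} → u ≢ v → rank u ≡ suc (rank′ u)
    rank-other {u} u≢v rewrite dec-false (u ≟ v) u≢v = refl

    injective : ∀ {u w} → removed s u ≡ false → removed s w ≡ false → rank u ≡ rank w → u ≡ w
    injective {u} {w} ru rw eq with u ≟ v | w ≟ v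
    ... | yes refl | yes refl = refl
    ... | yes refl | no w≢v   = ⊥-elim (0≢1+n eq)
    ... | no u≢v   | yes refl = ⊥-elim (0≢1+n (sym eq))
    ... | no u≢v   | no w≢v   =
      injective′ (trans (removed-remove-other G {s} {v} u≢v) ru)
                 (trans (removed-remove-other G {s} {v} w≢v) rw)
                 (suc-injective eq)

    source : IsLiveSource (rankArc G rank) s v
    source u _ = trans (cong (λ r → Adj G u v ∧ does (rank u <? r)) rank-self) (∧-zeroʳ _)

    out : ∀ w → removed s w ≡ false → Adj G v w ≡ rankArc G rank v w
    out w _ with w ≟ v
    ... | yes refl rewrite Graph.irrefl G v = refl
    ... | no _ = sym (trans (cong (λ x → Adj G v w ∧ does (x <? suc (rank′ w))) rank-self)
                            (∧-identityʳ _))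

    coloured : ParityColoured (rankArc G rank) s′
    coloured = parityColoured-cong {s = s′} agree coloured′
      where
      agree : ∀ u w → removed s′ u ≡ false → removed s′ w ≡ false →
              rankArc G rank′ u w ≡ rankArc G rank u w
      agree u w ru rw = cong₂ (λ x y → Adj G u w ∧ does (x <? y))
                              (sym (rank-other (removed-remove⇒≢ G {s} {v} ru)))
                              (sym (rank-other (removed-remove⇒≢ G {s} {v} rw)))

lemma3 : ∀ (n : ℕ) (G : Graph n) (T : Fin n → Bool) →
         (∃ λ (D : Orientation G) → Acyclic D × IsTOdd T D) ⇔ Winnable G T
lemma3 n G T = mk⇔ winnable orientable
  where
  winnable : (∃ λ (D : Orientation G) → Acyclic D × IsTOdd T D) → Winnable G T
  winnable (D , acyclic , tOdd) =
    parityColoured⇒clearable D acyclic _ refl (Equivalence.from (parityColoured-initial D) tOdd)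

  orientable : Winnable G T → ∃ λ (D : Orientation G) → Acyclic D × IsTOdd T D
  orientable (_ , moves , done) with winningPlay⇒ranking G moves done
  ... | rank , injective , coloured =
    let D = rankOrientation G rank (injective refl refl)
    in D , ranked⇒acyclic rank (rankArc⇒< {G = G})
         , Equivalence.to (parityColoured-initial D) coloured
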